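{- Let $c$ be a Coxeter element of $\widetilde S_n$, encoded as a partition of $\{1,\ldots,n\}$ into inner points and outer points (see context). If $a_1<\cdots<a_k$ are the outer points and $b_1>\cdots>b_{n-k}$ are the inner points, then $$c=(\cdots\ a_1\ a_2\ \cdots\ a_k\ \ a_1+n\ \cdots)(\cdots\ b_1\ b_2\ \cdots\ b_{n-k}\ \ b_1-n\ \cdots).$$
   Context: Fix $n\ge2$. $\widetilde S_n$ is the group of bijections $\pi:\mathbb Z\to\mathbb Z$ with $\pi(i+n)=\pi(i)+n$ for all $i$ and $\sum_{i=1}^n\pi(i)=\binom{n+1}{2}$; it is a Coxeter group of type $\widetilde A_{n-1}$ with simple reflections $s_i$ ($i=1,\ldots,n$, indices mod $n$, $s_0=s_n$), where $s_i$ swaps $i+kn$ and $i+1+kn$ for all $k$. A Coxeter element is a product of $s_1,\ldots,s_n$ in some order, each once. Encoding: the point $i\in\{1,\dots,n\}$ is outer if $s_{i-1}$ precedes $s_i$ in (every reduced word for) $c$, and inner if $s_i$ precedes $s_{i-1}$; there is at least one outer and at least one inner point. An infinite cycle $(\cdots\ a_1\ \cdots\ a_k\ \ a_1+qn\ \cdots)$, $q\neq0$, denotes the permutation of the bi-infinite sequence $\ldots,a_1,\ldots,a_k,a_1+qn,\ldots,a_k+qn,a_1+2qn,\ldots$ (extended backwards similarly) sending each entry to the next, fixing integers not in the sequence. -}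

module Defs where

open import Data.Nat as ℕ using (ℕ; zero; suc; _≤_; _<_; _>_)
open import Data.Nat.Divisibility using (_∣?_)
open import Data.Integer as ℤ using (ℤ; +_; ∣_∣)
open import Data.List using (List; []; _∷_; _++_; foldr; map; upTo)
open import Data.List.Membership.Propositional using (_∈_)
open import Data.Product using (∃-syntax; _×_)
open import Relation.Nullary.Decidable using (does)
open import Data.Bool using (if_then_else_)
open import Relation.Binary.PropositionalEquality using (_≡_)
open import Function using (_∘_; id)

-- The simple reflection s_i of the affine symmetric group S̃_n, as a map ℤ → ℤ:
-- it swaps i + kn and i + 1 + kn for all k (indices read mod n, so s_0 = s_n).
-- "x ≡ i (mod n)" is tested as  n ∣ |x - i|.
simpleRefl : (n i : ℕ) → ℤ → ℤ
simpleRefl n i x =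
  if does (n ∣? ∣ x ℤ.- + i ∣) then x ℤ.+ ℤ.1ℤ
  else if does (n ∣? ∣ x ℤ.- + suc i ∣) then x ℤ.- ℤ.1ℤ
  else x

product : (n : ℕ) → List ℕ → ℤ → ℤ
product n w = foldr (λ i f → simpleRefl n i ∘ f) id w

indices : ℕ → List ℕ
indices n = map suc (upTo n)

Precedes : List ℕ → ℕ → ℕ → Set
Precedes w i j = ∃[ xs ] ∃[ ys ] ∃[ zs ] (w ≡ xs ++ i ∷ ys ++ j ∷ zs)

-- Index i - 1 taken in {1,…,n} (so the predecessor of 1 is n, i.e. s_0 = s_n).
prevIdx : ℕ → ℕ → ℕ
prevIdx n zero = n
prevIdx n (suc zero) = n
prevIdx n (suc (suc k)) = suc k

Outer : (n : ℕ) → List ℕ → ℕ → Set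
Outer n w i = Precedes w (prevIdx n i) i

Inner : (n : ℕ) → List ℕ → ℕ → Set
Inner n w i = Precedes w i (prevIdx n i)

-- The infinite cycle ( ⋯ a₁ ⋯ a_k  a₁+qn ⋯ ), for entries a₁,…,a_k lying in distinct
-- residue classes mod qn.  The entry a_j + t·qn is sent to a_{j+1} + t·qn, i.e. x ↦ x - a_j + a_{j+1},
-- and a_k + t·qn is sent to a₁ + (t+1)·qn, i.e. x ↦ x - a_k + a₁ + qn; all other integers are fixed.
private
  cycStep : (n : ℕ) (q : ℤ) (a₁ : ℤ) → List ℤ → ℤ → ℤ
  cycStep n q a₁ [] x = x
  cycStep n q a₁ (a ∷ []) x =
    if does ((∣ q ∣ ℕ.* n) ∣? ∣ x ℤ.- a ∣) then x ℤ.- a ℤ.+ a₁ ℤ.+ q ℤ.* + n else x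
  cycStep n q a₁ (a ∷ b ∷ rest) x =
    if does ((∣ q ∣ ℕ.* n) ∣? ∣ x ℤ.- a ∣) then x ℤ.- a ℤ.+ b else cycStep n q a₁ (b ∷ rest) x

infCycle : (n : ℕ) (q : ℤ) → List ℤ → ℤ → ℤ
infCycle n q [] x = x
infCycle n q (a₁ ∷ as) x = cycStep n q a₁ (a₁ ∷ as) x

{-# OPTIONS --safe #-}
-- Let x ≡ r (mod n) with 1 ≤ r ≤ n.  Of the letters of c only s_{r-1} and s_r move x, and c acts
-- starting from its rightmost letter.  If r is outer, s_r acts first and raises x to x+1; the class
-- r+1 is then moved again, by s_{r+1}, exactly when r+1 is inner, and so on: x climbs through the
-- run of inner points after r and stops at the next outer point, wrapping from n to 1 at the cost of
-- a shift by n.  This is the first infinite cycle.  Dually, if r is inner, x descends through the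
-- outer points below r to the next inner point, as in the second cycle.  Every point is either
-- outer or inner, so exactly one of the two cycles moves x, and its image lies in a class that the
-- other cycle fixes.
module Submission where

open import Data.Bool using (true; false)
open import Data.Empty using (⊥-elim)
open import Data.Integer as ℤ using (ℤ; +_; ∣_∣; 0ℤ; 1ℤ; -1ℤ)
import Data.Integer.Properties as ℤP
open import Data.Integer.Divisibility.Signed as ℤD using (_∣_; divides)
open import Data.Integer.DivMod using (a≡a%ℕn+[a/ℕn]*n; n%ℕd<d; _%ℕ_; _/ℕ_)
open import Data.Integer.Solver using (module +-*-Solver)
open import Data.List using (List; []; _∷_; _++_; map)
import Data.List.Properties as ListP
open import Data.List.Membership.Propositional using (_∈_; _∉_)
open import Data.List.Membership.Propositional.Properties
  using (∈-++⁺ˡ; ∈-++⁺ʳ; ∈-++⁻; ∈-∃++; ∈-map⁺; ∈-map⁻; ∈-upTo⁺; ∈-upTo⁻)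
open import Data.List.Relation.Binary.Permutation.Propositional using (_↭_; ↭-sym; ↭⇒↭ₛ)
open import Data.List.Relation.Binary.Permutation.Propositional.Properties using (∈-resp-↭)
import Data.List.Relation.Binary.Permutation.Setoid.Properties as PermutationS
open import Data.List.Relation.Unary.All as All using (All; []; _∷_)
open import Data.List.Relation.Unary.AllPairs using (AllPairs; []; _∷_)
open import Data.List.Relation.Unary.Any using (here; there)
open import Data.List.Relation.Unary.Unique.Propositional using (Unique)
import Data.List.Relation.Unary.Unique.Propositional.Properties as UniqueP
open import Data.Nat as ℕ using (ℕ; zero; suc; _≤_; _<_; _>_; s≤s; z≤n)
open import Data.Nat.Divisibility as ℕD using () renaming (_∣_ to _∣ℕ_)
import Data.Nat.Properties as ℕP
open import Data.Product using (∃; ∃₂; ∃-syntax; _×_; _,_; proj₁; proj₂)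
open import Data.Sum using (_⊎_; inj₁; inj₂; [_,_]′)
open import Function using (_∘_; id; flip)
open import Function.Bundles using (_⇔_; Equivalence)
open import Relation.Binary.PropositionalEquality
open import Relation.Nullary using (¬_; yes; no; does)
open import Relation.Nullary.Decidable using (dec-true; dec-false)
open import Defs
open +-*-Solver

module _ {A : Set} {R : A → A → Set} where

  AllPairs-++⁻ʳ : ∀ xs {ys} → AllPairs R (xs ++ ys) → AllPairs R ys
  AllPairs-++⁻ʳ []       rs       = rs
  AllPairs-++⁻ʳ (_ ∷ xs) (_ ∷ rs) = AllPairs-++⁻ʳ xs rs

  AllPairs-++⁻-across : ∀ xs {ys a b} → AllPairs R (xs ++ ys) → a ∈ xs → b ∈ ys → R a b
  AllPairs-++⁻-across (_ ∷ xs) (r ∷ _)  (here refl) b∈ = All.lookup r (∈-++⁺ʳ xs b∈)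
  AllPairs-++⁻-across (_ ∷ xs) (_ ∷ rs) (there a∈)  b∈ = AllPairs-++⁻-across xs rs a∈ b∈

Unique-split-unique : ∀ {A : Set} (u u′ : List A) {i v v′} →
  Unique (u ++ i ∷ v) → u ++ i ∷ v ≡ u′ ++ i ∷ v′ → u ≡ u′ × v ≡ v′
Unique-split-unique []      []       _        refl = refl , refl
Unique-split-unique []      (_ ∷ u′) (i∉ ∷ _) refl = ⊥-elim (All.lookup i∉ (∈-++⁺ʳ u′ (here refl)) refl)
Unique-split-unique (_ ∷ u) []       (i∉ ∷ _) refl = ⊥-elim (All.lookup i∉ (∈-++⁺ʳ u (here refl)) refl)
Unique-split-unique (_ ∷ u) (_ ∷ u′) (_ ∷ un) eq with ListP.∷-injective eq
... | refl , eq′ with Unique-split-unique u u′ un eq′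
...   | refl , v≡v′ = refl , v≡v′

module Sorted {A : Set} {_≺_ : A → A → Set} (≺-asym : ∀ {a b} → a ≺ b → ¬ b ≺ a) where

  private
    ≺-irrefl : ∀ {a} → ¬ a ≺ a
    ≺-irrefl a≺a = ≺-asym a≺a a≺a

  consecutive-≺ : ∀ {L r e} pre post → AllPairs _≺_ L → L ≡ pre ++ r ∷ e ∷ post → r ≺ e
  consecutive-≺ pre post sorted refl with AllPairs-++⁻ʳ pre sorted
  ... | r≺ ∷ _ = All.lookup r≺ (here refl)

  consecutive-gap : ∀ {L r e p} pre post → AllPairs _≺_ L → L ≡ pre ++ r ∷ e ∷ post →
    r ≺ p → p ≺ e → p ∉ L
  consecutive-gap pre post sorted refl r≺p p≺e p∈ with ∈-++⁻ pre p∈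
  ... | inj₁ p∈pre                  = ≺-asym r≺p (AllPairs-++⁻-across pre sorted p∈pre (here refl))
  ... | inj₂ (here refl)            = ≺-irrefl r≺p
  ... | inj₂ (there (here refl))    = ≺-irrefl p≺e
  ... | inj₂ (there (there p∈post)) with AllPairs-++⁻ʳ pre sorted
  ...   | _ ∷ e≺ ∷ _ = ≺-asym p≺e (All.lookup e≺ p∈post)

  last-gap : ∀ {L r p} pre → AllPairs _≺_ L → L ≡ pre ++ r ∷ [] → r ≺ p → p ∉ L
  last-gap pre sorted refl r≺p p∈ with ∈-++⁻ pre p∈
  ... | inj₁ p∈pre       = ≺-asym r≺p (AllPairs-++⁻-across pre sorted p∈pre (here refl))
  ... | inj₂ (here refl) = ≺-irrefl r≺p

  head-gap : ∀ {a L p} → AllPairs _≺_ (a ∷ L) → p ≺ a → p ∉ a ∷ L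
  head-gap _        p≺a (here refl) = ≺-irrefl p≺a
  head-gap (a≺ ∷ _) p≺a (there p∈)  = ≺-asym p≺a (All.lookup a≺ p∈)

Precedes⇒∈ˡ : ∀ {w i j} → Precedes w i j → i ∈ w
Precedes⇒∈ˡ (xs , _ , _ , refl) = ∈-++⁺ʳ xs (here refl)

Precedes⇒∈ʳ : ∀ {w i j} → Precedes w i j → j ∈ w
Precedes⇒∈ʳ (xs , ys , _ , refl) = ∈-++⁺ʳ xs (there (∈-++⁺ʳ ys (here refl)))

Precedes-total : ∀ {w i j} → i ∈ w → j ∈ w → i ≢ j → Precedes w i j ⊎ Precedes w j i
Precedes-total (here refl) (here refl) i≢j = ⊥-elim (i≢j refl)
Precedes-total (here refl) (there j∈) _ with ∈-∃++ j∈
... | ys , zs , refl = inj₁ ([] , ys , zs , refl)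
Precedes-total (there i∈) (here refl) _ with ∈-∃++ i∈
... | ys , zs , refl = inj₂ ([] , ys , zs , refl)
Precedes-total {a ∷ _} (there i∈) (there j∈) i≢j with Precedes-total i∈ j∈ i≢j
... | inj₁ (xs , ys , zs , eq) = inj₁ (a ∷ xs , ys , zs , cong (a ∷_) eq)
... | inj₂ (xs , ys , zs , eq) = inj₂ (a ∷ xs , ys , zs , cong (a ∷_) eq)

module Precedence {w : List ℕ} (w-unique : Unique w) where

  private
    unique-at : ∀ {u i v} → w ≡ u ++ i ∷ v → Unique (u ++ i ∷ v)
    unique-at refl = w-unique

  ∉-prefix : ∀ {u i v} → w ≡ u ++ i ∷ v → i ∉ u
  ∉-prefix {u} eq i∈u = AllPairs-++⁻-across u (unique-at eq) i∈u (here refl) refl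

  ∉-suffix : ∀ {u i v} → w ≡ u ++ i ∷ v → i ∉ v
  ∉-suffix {u} eq i∈v with AllPairs-++⁻ʳ u (unique-at eq)
  ... | i∉ ∷ _ = All.lookup i∉ i∈v refl

  Precedes⇒∉-prefix : ∀ {u i v j} → w ≡ u ++ i ∷ v → Precedes w i j → j ∉ u
  Precedes⇒∉-prefix {u} eq (xs , ys , _ , eq′) j∈u
    with Unique-split-unique u xs (unique-at eq) (trans (sym eq) eq′)
  ... | refl , _ = AllPairs-++⁻-across u (unique-at eq′) j∈u (there (∈-++⁺ʳ ys (here refl))) refl

  Precedes⇒split : ∀ {u i v j} → w ≡ u ++ i ∷ v → Precedes w j i →
    ∃₂ λ xs ys → u ≡ xs ++ j ∷ ys × w ≡ xs ++ j ∷ ys ++ i ∷ v × j ∉ ys × i ∉ ys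
  Precedes⇒split {u} {i} {j = j} eq (xs , ys , zs , eq′)
    with Unique-split-unique u (xs ++ j ∷ ys) (unique-at eq)
           (trans (sym eq) (trans eq′ (sym (ListP.++-assoc xs (j ∷ ys) (i ∷ zs)))))
  ... | refl , refl = xs , ys , refl , eq′ , ∉-suffix eq′ ∘ ∈-++⁺ˡ , ∉-prefix eq ∘ ∈-++⁺ʳ xs ∘ there

  Precedes-asym : ∀ {i j} → Precedes w i j → ¬ Precedes w j i
  Precedes-asym {i} {j} (xs , ys , zs , eq) j≺i =
    Precedes⇒∉-prefix (trans eq (sym (ListP.++-assoc xs (i ∷ ys) (j ∷ zs)))) j≺i (∈-++⁺ʳ xs (here refl))

module Action (n : ℕ) (n≥2 : 2 ≤ n) where

  n>0 : 0 < n
  n>0 = ℕP.<-≤-trans (s≤s z≤n) n≥2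

  Point : ℕ → Set
  Point i = 1 ≤ i × i ≤ n

  Enumerates : (ℕ → Set) → List ℕ → Set
  Enumerates P L = ∀ p → p ∈ L ⇔ (Point p × P p)

  Enumerates⇒Points : ∀ {P L} → Enumerates P L → All Point L
  Enumerates⇒Points enum = All.tabulate (λ {p} → proj₁ ∘ Equivalence.to (enum p))

  -- x ≡ᵣ a : x ≡ a (mod n).  A record, so that x and a can be inferred from the type.
  record _≡ᵣ_ (x : ℤ) (a : ℕ) : Set where
    constructor mk≡ᵣ
    field n∣x-a : + n ∣ x ℤ.- + a
  open _≡ᵣ_ public

  infix 4 _≡ᵣ_

  ≡ᵣ⇒∣ℕ : ∀ {x a} → x ≡ᵣ a → n ∣ℕ ∣ x ℤ.- + a ∣
  ≡ᵣ⇒∣ℕ = ℤD.∣⇒∣ᵤ ∘ n∣x-a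

  ∣ℕ⇒≡ᵣ : ∀ {x a} → n ∣ℕ ∣ x ℤ.- + a ∣ → x ≡ᵣ a
  ∣ℕ⇒≡ᵣ = mk≡ᵣ ∘ ℤD.∣ᵤ⇒∣

  ≡ᵣ-shift : ∀ {x a y b} k → y ℤ.- + b ≡ (x ℤ.- + a) ℤ.+ k ℤ.* + n → x ≡ᵣ a → y ≡ᵣ b
  ≡ᵣ-shift k eq (mk≡ᵣ n∣) =
    mk≡ᵣ (subst (+ n ∣_) (sym eq) (ℤD.∣m∣n⇒∣m+n n∣ (ℤD.∣n⇒∣m*n k ℤD.∣-refl)))

  ≡ᵣ-suc : ∀ {x a} → x ≡ᵣ a → x ℤ.+ 1ℤ ≡ᵣ suc a
  ≡ᵣ-suc {x} {a} = ≡ᵣ-shift 0ℤ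
    (solve 3 (λ x a m → (x :+ con 1ℤ) :- (con 1ℤ :+ a) := (x :- a) :+ con 0ℤ :* m) refl x (+ a) (+ n))

  ≡ᵣ-pred : ∀ {x a} → x ≡ᵣ suc a → x ℤ.- 1ℤ ≡ᵣ a
  ≡ᵣ-pred {x} {a} = ≡ᵣ-shift 0ℤ
    (solve 3 (λ x a m → (x :- con 1ℤ) :- a := (x :- (con 1ℤ :+ a)) :+ con 0ℤ :* m) refl x (+ a) (+ n))

  ≡ᵣ-+n⁻ : ∀ {x a} → x ≡ᵣ a ℕ.+ n → x ≡ᵣ a
  ≡ᵣ-+n⁻ {x} {a} = ≡ᵣ-shift 1ℤ
    (solve 3 (λ x a m → x :- a := (x :- (a :+ m)) :+ con 1ℤ :* m) refl x (+ a) (+ n))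

  ≡ᵣ-+n⁺ : ∀ {x a} → x ≡ᵣ a → x ≡ᵣ a ℕ.+ n
  ≡ᵣ-+n⁺ {x} {a} = ≡ᵣ-shift -1ℤ
    (solve 3 (λ x a m → x :- (a :+ m) := (x :- a) :+ con -1ℤ :* m) refl x (+ a) (+ n))

  ≡ᵣ-relocate : ∀ {x r} e → x ≡ᵣ r → x ℤ.- + r ℤ.+ + e ≡ᵣ e
  ≡ᵣ-relocate {x} {r} e = ≡ᵣ-shift 0ℤ
    (solve 4 (λ x r e m → x :- r :+ e :- e := (x :- r) :+ con 0ℤ :* m) refl x (+ r) (+ e) (+ n))

  ≡ᵣ-relocate-wrap : ∀ {x r} e k → x ≡ᵣ r → x ℤ.- + r ℤ.+ + e ℤ.+ k ℤ.* + n ≡ᵣ e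
  ≡ᵣ-relocate-wrap {x} {r} e k = ≡ᵣ-shift k
    (solve 5 (λ x r e m k → x :- r :+ e :+ k :* m :- e := (x :- r) :+ k :* m) refl x (+ r) (+ e) (+ n) k)

  private
    multiple-below-n : ∀ {d} → d < n → n ∣ℕ d → d ≡ 0
    multiple-below-n {zero}  _   _   = refl
    multiple-below-n {suc d} d<n n∣d = ⊥-elim (ℕD.>⇒∤ d<n n∣d)

    congruent-points-≤ : ∀ {i j} → 1 ≤ i → i ≤ j → j ≤ n → n ∣ℕ ∣ j ℤ.⊖ i ∣ → j ≤ i
    congruent-points-≤ 1≤i i≤j j≤n n∣ = ℕP.m∸n≡0⇒m≤n (multiple-below-n
      (ℕP.<-≤-trans (ℕP.∸-monoʳ-< 1≤i i≤j) j≤n)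
      (subst (n ∣ℕ_) (cong ∣_∣ (ℤP.⊖-≥ i≤j)) n∣))

    congruent-points-≡ : ∀ {i j} → Point i → Point j → n ∣ℕ ∣ j ℤ.⊖ i ∣ → i ≡ j
    congruent-points-≡ {i} {j} (1≤i , i≤n) (1≤j , j≤n) n∣j⊖i with ℕP.≤-total i j
    ... | inj₁ i≤j = ℕP.≤-antisym i≤j (congruent-points-≤ 1≤i i≤j j≤n n∣j⊖i)
    ... | inj₂ j≤i = ℕP.≤-antisym
      (congruent-points-≤ 1≤j j≤i i≤n (subst (n ∣ℕ_) (ℤP.∣m⊖n∣≡∣n⊖m∣ j i) n∣j⊖i)) j≤i

  residue-unique : ∀ {x i j} → Point i → Point j → x ≡ᵣ i → x ≡ᵣ j → i ≡ j
  residue-unique {x} {i} {j} i-pt j-pt (mk≡ᵣ n∣x-i) (mk≡ᵣ n∣x-j) =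
    congruent-points-≡ i-pt j-pt (ℤD.∣⇒∣ᵤ (subst (+ n ∣_) x-i-[x-j]≡j⊖i (ℤD.∣m∣n⇒∣m-n n∣x-i n∣x-j)))
    where
    x-i-[x-j]≡j⊖i : (x ℤ.- + i) ℤ.- (x ℤ.- + j) ≡ j ℤ.⊖ i
    x-i-[x-j]≡j⊖i = trans (solve 3 (λ x i j → (x :- i) :- (x :- j) := j :- i) refl x (+ i) (+ j))
                          (ℤP.m-n≡m⊖n j i)

  residue-exists : ∀ x → ∃[ r ] (Point r × x ≡ᵣ r)
  residue-exists x = from-remainder (x %ℕ n) (n%ℕd<d x n) (mk≡ᵣ (divides (x /ℕ n) x-ρ≡qn))
    where
    instance
      n≢0 : ℕ.NonZero n
      n≢0 = ℕ.>-nonZero n>0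

    x-ρ≡qn : x ℤ.- + (x %ℕ n) ≡ (x /ℕ n) ℤ.* + n
    x-ρ≡qn = begin
      x ℤ.- + (x %ℕ n)
        ≡⟨ cong (ℤ._- + (x %ℕ n)) (a≡a%ℕn+[a/ℕn]*n x n) ⟩
      + (x %ℕ n) ℤ.+ (x /ℕ n) ℤ.* + n ℤ.- + (x %ℕ n)
        ≡⟨ solve 2 (λ ρ t → ρ :+ t :- ρ := t) refl (+ (x %ℕ n)) ((x /ℕ n) ℤ.* + n) ⟩
      (x /ℕ n) ℤ.* + n
        ∎
      where open ≡-Reasoning

    from-remainder : ∀ ρ → ρ < n → x ≡ᵣ ρ → ∃[ r ] (Point r × x ≡ᵣ r)
    from-remainder zero    _   x≡0 = n , (n>0 , ℕP.≤-refl) , ≡ᵣ-+n⁺ x≡0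
    from-remainder (suc ρ) ρ<n x≡ρ = suc ρ , (s≤s z≤n , ℕP.<⇒≤ ρ<n) , x≡ρ

  data _⋖_ : ℕ → ℕ → Set where
    step : ∀ {k} → suc k < n → suc k ⋖ suc (suc k)
    wrap : n ⋖ 1

  ⋖-prev : ∀ {j j′} → j ⋖ j′ → prevIdx n j′ ≡ j
  ⋖-prev (step _) = refl
  ⋖-prev wrap     = refl

  prev-⋖ : ∀ {p} → Point p → prevIdx n p ⋖ p
  prev-⋖ {suc zero}    _         = wrap
  prev-⋖ {suc (suc k)} (_ , p≤n) = step p≤n

  ⋖-from : ∀ {j} → Point j → ∃ (j ⋖_)
  ⋖-from {suc k} (_ , j≤n) with ℕP.m≤n⇒m<n∨m≡n j≤n
  ... | inj₁ j<n  = suc (suc k) , step j<n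
  ... | inj₂ refl = 1 , wrap

  ⋖-suc : ∀ {j} → 1 ≤ j → j < n → j ⋖ suc j
  ⋖-suc {suc _} _ j<n = step j<n

  ⋖-pointˡ : ∀ {j j′} → j ⋖ j′ → Point j
  ⋖-pointˡ (step j<n) = s≤s z≤n , ℕP.<⇒≤ j<n
  ⋖-pointˡ wrap       = n>0 , ℕP.≤-refl

  ⋖-pointʳ : ∀ {j j′} → j ⋖ j′ → Point j′
  ⋖-pointʳ (step j<n) = s≤s z≤n , j<n
  ⋖-pointʳ wrap       = s≤s z≤n , n>0

  ⋖⇒≢ : ∀ {j j′} → j ⋖ j′ → j ≢ j′
  ⋖⇒≢ (step _) = ℕP.<⇒≢ (ℕP.n<1+n _)
  ⋖⇒≢ wrap     = ℕP.<⇒≢ n≥2 ∘ sym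

  prevIdx-suc : ∀ {k} → 1 ≤ k → prevIdx n (suc k) ≡ k
  prevIdx-suc {suc _} _ = refl

  ≡ᵣ-suc-⋖ : ∀ {x j j′} → j ⋖ j′ → x ≡ᵣ suc j → x ≡ᵣ j′
  ≡ᵣ-suc-⋖ (step _) = id
  ≡ᵣ-suc-⋖ wrap     = ≡ᵣ-+n⁻

  ≡ᵣ-⋖-suc : ∀ {x j j′} → j ⋖ j′ → x ≡ᵣ j′ → x ≡ᵣ suc j
  ≡ᵣ-⋖-suc (step _) = id
  ≡ᵣ-⋖-suc wrap     = ≡ᵣ-+n⁺

  ≡ᵣ-pred-prev : ∀ {x p} → Point p → x ≡ᵣ p → x ℤ.- 1ℤ ≡ᵣ prevIdx n p
  ≡ᵣ-pred-prev p-pt = ≡ᵣ-pred ∘ ≡ᵣ-⋖-suc (prev-⋖ p-pt)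

  simpleRefl-raise : ∀ {x i} → x ≡ᵣ i → simpleRefl n i x ≡ x ℤ.+ 1ℤ
  simpleRefl-raise {x} {i} x≡i rewrite dec-true (n ℕD.∣? ∣ x ℤ.- + i ∣) (≡ᵣ⇒∣ℕ x≡i) = refl

  ≡ᵣ-suc⇒prev : ∀ {x i r} → Point i → Point r → x ≡ᵣ suc i → x ≡ᵣ r → i ≡ prevIdx n r
  ≡ᵣ-suc⇒prev i-pt r-pt x≡suc-i x≡r with ⋖-from i-pt
  ... | i′ , i⋖i′ = trans (sym (⋖-prev i⋖i′))
    (cong (prevIdx n) (residue-unique (⋖-pointʳ i⋖i′) r-pt (≡ᵣ-suc-⋖ i⋖i′ x≡suc-i) x≡r))

  simpleRefl-lower : ∀ {x p} → Point p → x ≡ᵣ p → simpleRefl n (prevIdx n p) x ≡ x ℤ.- 1ℤ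
  simpleRefl-lower {x} {p} p-pt x≡p
    rewrite dec-false (n ℕD.∣? ∣ x ℤ.- + prevIdx n p ∣)
              (⋖⇒≢ (prev-⋖ p-pt) ∘ flip (residue-unique (⋖-pointˡ (prev-⋖ p-pt)) p-pt) x≡p ∘ ∣ℕ⇒≡ᵣ)
          | dec-true (n ℕD.∣? ∣ x ℤ.- + suc (prevIdx n p) ∣) (≡ᵣ⇒∣ℕ (≡ᵣ-⋖-suc (prev-⋖ p-pt) x≡p))
          = refl

  simpleRefl-fix : ∀ {x r i} → Point r → x ≡ᵣ r → Point i → i ≢ r → i ≢ prevIdx n r →
    simpleRefl n i x ≡ x
  simpleRefl-fix {x} {r} {i} r-pt x≡r i-pt i≢r i≢prev
    rewrite dec-false (n ℕD.∣? ∣ x ℤ.- + i ∣) (i≢r ∘ flip (residue-unique i-pt r-pt) x≡r ∘ ∣ℕ⇒≡ᵣ)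
          | dec-false (n ℕD.∣? ∣ x ℤ.- + suc i ∣) (i≢prev ∘ flip (≡ᵣ-suc⇒prev i-pt r-pt) x≡r ∘ ∣ℕ⇒≡ᵣ)
          = refl

  product-++ : ∀ u v x → product n (u ++ v) x ≡ product n u (product n v x)
  product-++ []      v x = refl
  product-++ (i ∷ u) v x = cong (simpleRefl n i) (product-++ u v x)

  product-fix : ∀ {x r} v → (∀ {i} → i ∈ v → Point i) → Point r → x ≡ᵣ r → r ∉ v → prevIdx n r ∉ v →
    product n v x ≡ x
  product-fix []      _      _    _   _   _      = refl
  product-fix (i ∷ v) points r-pt x≡r r∉ prev∉ = trans
    (cong (simpleRefl n i) (product-fix v (points ∘ there) r-pt x≡r (r∉ ∘ there) (prev∉ ∘ there)))
    (simpleRefl-fix r-pt x≡r (points (here refl)) (r∉ ∘ here ∘ sym) (prev∉ ∘ here ∘ sym))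

module InfiniteCycle (n : ℕ) (n≥2 : 2 ≤ n) (q : ℤ) (∣q∣≡1 : ∣ q ∣ ≡ 1) where
  open Action n n≥2

  private
    period≡n : ∣ q ∣ ℕ.* n ≡ n
    period≡n = trans (cong (ℕ._* n) ∣q∣≡1) (ℕP.*-identityˡ n)

    test-in : ∀ {x a} → x ≡ᵣ a → does (∣ q ∣ ℕ.* n ℕD.∣? ∣ x ℤ.- + a ∣) ≡ true
    test-in = dec-true (_ ℕD.∣? _) ∘ subst (_∣ℕ _) (sym period≡n) ∘ ≡ᵣ⇒∣ℕ

    test-out : ∀ {x a} → ¬ x ≡ᵣ a → does (∣ q ∣ ℕ.* n ℕD.∣? ∣ x ℤ.- + a ∣) ≡ false
    test-out x≢a = dec-false (_ ℕD.∣? _) (x≢a ∘ ∣ℕ⇒≡ᵣ ∘ subst (_∣ℕ _) period≡n)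

  infCycle-skip : ∀ {x a₁ b} L → ¬ x ≡ᵣ a₁ → ¬ x ≡ᵣ b →
    infCycle n q (+ a₁ ∷ + b ∷ L) x ≡ infCycle n q (+ a₁ ∷ L) x
  infCycle-skip []      x≢a₁ x≢b rewrite test-out x≢a₁ | test-out x≢b = refl
  infCycle-skip (_ ∷ _) x≢a₁ x≢b rewrite test-out x≢a₁ | test-out x≢b = refl

  infCycle-head : ∀ {x a₁ c} L → x ≡ᵣ a₁ → infCycle n q (+ a₁ ∷ c ∷ L) x ≡ x ℤ.- + a₁ ℤ.+ c
  infCycle-head _ x≡a₁ rewrite test-in x≡a₁ = refl

  infCycle-head-only : ∀ {x a₁} → x ≡ᵣ a₁ → infCycle n q (+ a₁ ∷ []) x ≡ x ℤ.- + a₁ ℤ.+ + a₁ ℤ.+ q ℤ.* + n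
  infCycle-head-only x≡a₁ rewrite test-in x≡a₁ = refl

  infCycle-second : ∀ {x a₁ b c} L → ¬ x ≡ᵣ a₁ → x ≡ᵣ b →
    infCycle n q (+ a₁ ∷ + b ∷ c ∷ L) x ≡ x ℤ.- + b ℤ.+ c
  infCycle-second _ x≢a₁ x≡b rewrite test-out x≢a₁ | test-in x≡b = refl

  infCycle-second-last : ∀ {x a₁ b} → ¬ x ≡ᵣ a₁ → x ≡ᵣ b →
    infCycle n q (+ a₁ ∷ + b ∷ []) x ≡ x ℤ.- + b ℤ.+ + a₁ ℤ.+ q ℤ.* + n
  infCycle-second-last x≢a₁ x≡b rewrite test-out x≢a₁ | test-in x≡b = refl

  infCycle-fix : ∀ {x} L → (∀ {a} → a ∈ L → ¬ x ≡ᵣ a) → infCycle n q (map +_ L) x ≡ x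
  infCycle-fix []       _    = refl
  infCycle-fix {x} (a₁ ∷ L) x≢L = trans (skip-all L (x≢L ∘ there)) fix-head
    where
    skip-all : ∀ L → (∀ {a} → a ∈ L → ¬ x ≡ᵣ a) →
      infCycle n q (+ a₁ ∷ map +_ L) x ≡ infCycle n q (+ a₁ ∷ []) x
    skip-all []      _    = refl
    skip-all (b ∷ L) x≢bL = trans (infCycle-skip (map +_ L) (x≢L (here refl)) (x≢bL (here refl)))
                                  (skip-all L (x≢bL ∘ there))
    fix-head : infCycle n q (+ a₁ ∷ []) x ≡ x
    fix-head rewrite test-out (x≢L (here refl)) = refl

  Consecutive : List ℕ → ℕ → ℕ → Set
  Consecutive L r e = ∃₂ λ pre post → L ≡ pre ++ r ∷ e ∷ post

  Last : List ℕ → ℕ → Set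
  Last L r = ∃ λ pre → L ≡ pre ++ r ∷ []

  CycleImage : ℕ → List ℕ → ℕ → ℤ → ℤ → Set
  CycleImage a₁ L r x y =
    (∃ λ e → Consecutive L r e × y ≡ x ℤ.- + r ℤ.+ + e) ⊎
    (Last L r × y ≡ x ℤ.- + r ℤ.+ + a₁ ℤ.+ q ℤ.* + n)

  private
    extend : ∀ {a₁ b L r x y} → CycleImage a₁ L r x y → CycleImage a₁ (b ∷ L) r x y
    extend {b = b} (inj₁ (e , (pre , post , eq) , y≡)) = inj₁ (e , (b ∷ pre , post , cong (b ∷_) eq) , y≡)
    extend {b = b} (inj₂ ((pre , eq) , y≡))             = inj₂ ((b ∷ pre , cong (b ∷_) eq) , y≡)

    tail-image : ∀ {x r a₁} L → ¬ x ≡ᵣ a₁ → All Point L → Point r → x ≡ᵣ r → r ∈ L →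
      CycleImage a₁ L r x (infCycle n q (+ a₁ ∷ map +_ L) x)
    tail-image {r = r} (b ∷ L) x≢a₁ (b-pt ∷ L-pts) r-pt x≡r r∈ with b ℕ.≟ r
    tail-image (b ∷ [])    x≢a₁ _ _ x≡r _ | yes refl =
      inj₂ (([] , refl) , infCycle-second-last x≢a₁ x≡r)
    tail-image (b ∷ e ∷ L) x≢a₁ _ _ x≡r _ | yes refl =
      inj₁ (e , ([] , L , refl) , infCycle-second (map +_ L) x≢a₁ x≡r)
    tail-image (b ∷ L) x≢a₁ (b-pt ∷ L-pts) r-pt x≡r (here r≡b)  | no b≢r = ⊥-elim (b≢r (sym r≡b))
    tail-image {x} {a₁ = a₁} (b ∷ L) x≢a₁ (b-pt ∷ L-pts) r-pt x≡r (there r∈) | no b≢r =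
      subst (CycleImage _ (b ∷ L) _ x) (sym (infCycle-skip (map +_ L) x≢a₁ x≢b))
        (extend {a₁} {x = x} (tail-image L x≢a₁ L-pts r-pt x≡r r∈))
      where
      x≢b : ¬ x ≡ᵣ b
      x≢b x≡b = b≢r (residue-unique b-pt r-pt x≡b x≡r)

  infCycle-image : ∀ {x r} a₁ L → All Point (a₁ ∷ L) → Point r → x ≡ᵣ r → r ∈ a₁ ∷ L →
    CycleImage a₁ (a₁ ∷ L) r x (infCycle n q (map +_ (a₁ ∷ L)) x)
  infCycle-image {r = r} a₁ L _ _ _ _ with a₁ ℕ.≟ r
  infCycle-image a₁ []      _ _ x≡r _ | yes refl = inj₂ (([] , refl) , infCycle-head-only x≡r)
  infCycle-image a₁ (e ∷ L) _ _ x≡r _ | yes refl =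
    inj₁ (e , ([] , L , refl) , infCycle-head (map +_ L) x≡r)
  infCycle-image a₁ L _ _ _ (here r≡a₁) | no a₁≢r = ⊥-elim (a₁≢r (sym r≡a₁))
  infCycle-image {x} a₁ L (a₁-pt ∷ L-pts) r-pt x≡r (there r∈) | no a₁≢r =
    extend {a₁} {x = x} (tail-image L (a₁≢r ∘ flip (residue-unique a₁-pt r-pt) x≡r) L-pts r-pt x≡r r∈)

  infCycle-≡ᵣ : ∀ {x r} L → All Point L → Point r → x ≡ᵣ r → r ∈ L →
    ∃[ e ] (e ∈ L × infCycle n q (map +_ L) x ≡ᵣ e)
  infCycle-≡ᵣ {x} {r} (a₁ ∷ L) L-pts r-pt x≡r r∈ = image-≡ᵣ (infCycle-image a₁ L L-pts r-pt x≡r r∈)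
    where
    image-≡ᵣ : ∀ {y} → CycleImage a₁ (a₁ ∷ L) r x y → ∃[ e ] (e ∈ a₁ ∷ L × y ≡ᵣ e)
    image-≡ᵣ (inj₁ (e , (pre , _ , eq) , refl)) =
      e , subst (e ∈_) (sym eq) (∈-++⁺ʳ pre (there (here refl))) , ≡ᵣ-relocate e x≡r
    image-≡ᵣ (inj₂ (_ , refl)) = a₁ , here refl , ≡ᵣ-relocate-wrap a₁ q x≡r

  infCycle-fix-outside : ∀ {y e} L → All Point L → Point e → y ≡ᵣ e → e ∉ L →
    infCycle n q (map +_ L) y ≡ y
  infCycle-fix-outside L L-pts e-pt y≡e e∉L =
    infCycle-fix L λ a∈ y≡a → e∉L (subst (_∈ L) (residue-unique (All.lookup L-pts a∈) e-pt y≡a y≡e) a∈)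

module CoxeterWord (n : ℕ) (n≥2 : 2 ≤ n) (w : List ℕ) (w↭ : w ↭ indices n) where
  open Action n n≥2

  w-unique : Unique w
  w-unique = PermutationS.Unique-resp-↭ (setoid ℕ) (↭⇒↭ₛ (↭-sym w↭))
    (UniqueP.map⁺ ℕP.suc-injective (UniqueP.upTo⁺ n))

  open Precedence w-unique

  ∈w⇒Point : ∀ {i} → i ∈ w → Point i
  ∈w⇒Point i∈ with ∈-map⁻ suc (∈-resp-↭ w↭ i∈)
  ... | _ , k∈ , refl = s≤s z≤n , ∈-upTo⁻ k∈

  Point⇒∈w : ∀ {i} → Point i → i ∈ w
  Point⇒∈w {suc _} (_ , i≤n) = ∈-resp-↭ (↭-sym w↭) (∈-map⁺ suc (∈-upTo⁺ i≤n))

  prefix-points : ∀ {u v} → w ≡ u ++ v → ∀ {i} → i ∈ u → Point i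
  prefix-points eq = ∈w⇒Point ∘ subst (_ ∈_) (sym eq) ∘ ∈-++⁺ˡ

  suffix-points : ∀ {u v} → w ≡ u ++ v → ∀ {i} → i ∈ v → Point i
  suffix-points {u} eq = ∈w⇒Point ∘ subst (_ ∈_) (sym eq) ∘ ∈-++⁺ʳ u

  Outer⇒Point : ∀ {p} → Outer n w p → Point p
  Outer⇒Point = ∈w⇒Point ∘ Precedes⇒∈ʳ

  Inner⇒Point : ∀ {p} → Inner n w p → Point p
  Inner⇒Point = ∈w⇒Point ∘ Precedes⇒∈ˡ

  Outer-or-Inner : ∀ {p} → Point p → Outer n w p ⊎ Inner n w p
  Outer-or-Inner p-pt with Precedes-total (Point⇒∈w p-pt) (Point⇒∈w (⋖-pointˡ (prev-⋖ p-pt)))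
                                          (⋖⇒≢ (prev-⋖ p-pt) ∘ sym)
  ... | inj₁ inner = inj₂ inner
  ... | inj₂ outer = inj₁ outer

  ¬Outer⇒Inner : ∀ {p} → Point p → ¬ Outer n w p → Inner n w p
  ¬Outer⇒Inner p-pt ¬outer with Outer-or-Inner p-pt
  ... | inj₁ outer = ⊥-elim (¬outer outer)
  ... | inj₂ inner = inner

  ¬Inner⇒Outer : ∀ {p} → Point p → ¬ Inner n w p → Outer n w p
  ¬Inner⇒Outer p-pt ¬inner with Outer-or-Inner p-pt
  ... | inj₁ outer = outer
  ... | inj₂ inner = ⊥-elim (¬inner inner)

  data Ascent : ℕ → ℕ → ℕ → Set where
    done  : ∀ {e} → Outer n w e → Ascent e 0 e
    climb : ∀ {j j′ m e} → Inner n w j → j ⋖ j′ → Ascent j′ m e → Ascent j (suc m) e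

  data Descent : ℕ → ℕ → ℕ → Set where
    done    : ∀ {e} → Inner n w e → Descent e 0 e
    descend : ∀ {p m e} → Outer n w p → Descent (prevIdx n p) m e → Descent p (suc m) e

  -- u is the part of w to the left of s_{j-1}, the reflection that has just moved y to j.
  ascent-product : ∀ {j m e} → Ascent j m e → ∀ u {v y} → w ≡ u ++ prevIdx n j ∷ v → y ≡ᵣ j →
    product n u y ≡ y ℤ.+ + m
  ascent-product (done outer) u eq y≡j = trans
    (product-fix u (prefix-points eq) (Outer⇒Point outer) y≡j (Precedes⇒∉-prefix eq outer) (∉-prefix eq))
    (sym (ℤP.+-identityʳ _))
  ascent-product {j} (climb {j′ = j′} {m} inner j⋖j′ ascent) u {v} {y} eq y≡j with Precedes⇒split eq inner
  ... | xs , ys , refl , eq′ , j∉ys , prev∉ys = begin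
    product n (xs ++ j ∷ ys) y
      ≡⟨ product-++ xs (j ∷ ys) y ⟩
    product n xs (simpleRefl n j (product n ys y))
      ≡⟨ cong (product n xs ∘ simpleRefl n j) ys-fix-y ⟩
    product n xs (simpleRefl n j y)
      ≡⟨ cong (product n xs) (simpleRefl-raise y≡j) ⟩
    product n xs (y ℤ.+ 1ℤ)
      ≡⟨ ascent-product ascent xs eq″ (≡ᵣ-suc-⋖ j⋖j′ (≡ᵣ-suc y≡j)) ⟩
    y ℤ.+ 1ℤ ℤ.+ + m
      ≡⟨ ℤP.+-assoc y 1ℤ (+ m) ⟩
    y ℤ.+ + suc m
      ∎
    where
    open ≡-Reasoning
    ys-fix-y : product n ys y ≡ y
    ys-fix-y = product-fix ys (suffix-points eq′ ∘ there ∘ ∈-++⁺ˡ) (Inner⇒Point inner) y≡j j∉ys prev∉ys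
    eq″ : w ≡ xs ++ prevIdx n j′ ∷ ys ++ prevIdx n j ∷ v
    eq″ = subst (λ t → w ≡ xs ++ t ∷ ys ++ prevIdx n j ∷ v) (sym (⋖-prev j⋖j′)) eq′

  -- u is the part of w to the left of s_p, the reflection that has just moved y to p.
  descent-product : ∀ {p m e} → Descent p m e → ∀ u {v y} → w ≡ u ++ p ∷ v → y ≡ᵣ p →
    product n u y ≡ y ℤ.- + m
  descent-product (done inner) u eq y≡p = trans
    (product-fix u (prefix-points eq) (Inner⇒Point inner) y≡p (∉-prefix eq) (Precedes⇒∉-prefix eq inner))
    (sym (ℤP.+-identityʳ _))
  descent-product {p} (descend {m = m} outer descent) u {v} {y} eq y≡p with Precedes⇒split eq outer
  ... | xs , ys , refl , eq′ , prev∉ys , p∉ys = begin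
    product n (xs ++ prevIdx n p ∷ ys) y
      ≡⟨ product-++ xs (prevIdx n p ∷ ys) y ⟩
    product n xs (simpleRefl n (prevIdx n p) (product n ys y))
      ≡⟨ cong (product n xs ∘ simpleRefl n (prevIdx n p)) ys-fix-y ⟩
    product n xs (simpleRefl n (prevIdx n p) y)
      ≡⟨ cong (product n xs) (simpleRefl-lower p-pt y≡p) ⟩
    product n xs (y ℤ.- 1ℤ)
      ≡⟨ descent-product descent xs eq′ (≡ᵣ-pred-prev p-pt y≡p) ⟩
    y ℤ.- 1ℤ ℤ.- + m
      ≡⟨ solve 2 (λ y m → y :- con 1ℤ :- m := y :- (con 1ℤ :+ m)) refl y (+ m) ⟩
    y ℤ.- + suc m
      ∎
    where
    open ≡-Reasoning
    p-pt : Point p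
    p-pt = Outer⇒Point outer
    ys-fix-y : product n ys y ≡ y
    ys-fix-y = product-fix ys (suffix-points eq′ ∘ there ∘ ∈-++⁺ˡ) p-pt y≡p p∉ys prev∉ys

  outer-product : ∀ {r r′ m e x} → Outer n w r → x ≡ᵣ r → r ⋖ r′ → Ascent r′ m e →
    product n w x ≡ x ℤ.+ 1ℤ ℤ.+ + m
  outer-product {r} {r′} {m} {x = x} outer@(xs , ys , zs , eq) x≡r r⋖r′ ascent = begin
    product n w x
      ≡⟨ cong (λ t → product n t x) eq₁ ⟩
    product n (u ++ r ∷ zs) x
      ≡⟨ product-++ u (r ∷ zs) x ⟩
    product n u (simpleRefl n r (product n zs x))
      ≡⟨ cong (product n u ∘ simpleRefl n r) zs-fix-x ⟩
    product n u (simpleRefl n r x)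
      ≡⟨ cong (product n u) (simpleRefl-raise x≡r) ⟩
    product n u (x ℤ.+ 1ℤ)
      ≡⟨ ascent-product ascent u eq₂ (≡ᵣ-suc-⋖ r⋖r′ (≡ᵣ-suc x≡r)) ⟩
    x ℤ.+ 1ℤ ℤ.+ + m
      ∎
    where
    open ≡-Reasoning
    u : List ℕ
    u = xs ++ prevIdx n r ∷ ys
    eq₁ : w ≡ u ++ r ∷ zs
    eq₁ = trans eq (sym (ListP.++-assoc xs (prevIdx n r ∷ ys) (r ∷ zs)))
    eq₂ : w ≡ u ++ prevIdx n r′ ∷ zs
    eq₂ = subst (λ t → w ≡ u ++ t ∷ zs) (sym (⋖-prev r⋖r′)) eq₁
    zs-fix-x : product n zs x ≡ x
    zs-fix-x = product-fix zs (suffix-points eq₁ ∘ there) (Outer⇒Point outer) x≡r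
      (∉-suffix eq₁) (∉-suffix eq ∘ ∈-++⁺ʳ ys ∘ there)

  inner-product : ∀ {r m e x} → Inner n w r → x ≡ᵣ r → Descent (prevIdx n r) m e →
    product n w x ≡ x ℤ.- 1ℤ ℤ.- + m
  inner-product {r} {m} {x = x} inner@(xs , ys , zs , eq) x≡r descent = begin
    product n w x
      ≡⟨ cong (λ t → product n t x) eq₁ ⟩
    product n (u ++ prevIdx n r ∷ zs) x
      ≡⟨ product-++ u (prevIdx n r ∷ zs) x ⟩
    product n u (simpleRefl n (prevIdx n r) (product n zs x))
      ≡⟨ cong (product n u ∘ simpleRefl n (prevIdx n r)) zs-fix-x ⟩
    product n u (simpleRefl n (prevIdx n r) x)
      ≡⟨ cong (product n u) (simpleRefl-lower r-pt x≡r) ⟩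
    product n u (x ℤ.- 1ℤ)
      ≡⟨ descent-product descent u eq₁ (≡ᵣ-pred-prev r-pt x≡r) ⟩
    x ℤ.- 1ℤ ℤ.- + m
      ∎
    where
    open ≡-Reasoning
    u : List ℕ
    u = xs ++ r ∷ ys
    r-pt : Point r
    r-pt = Inner⇒Point inner
    eq₁ : w ≡ u ++ prevIdx n r ∷ zs
    eq₁ = trans eq (sym (ListP.++-assoc xs (r ∷ ys) (prevIdx n r ∷ zs)))
    zs-fix-x : product n zs x ≡ x
    zs-fix-x = product-fix zs (suffix-points eq₁ ∘ there) r-pt x≡r
      (∉-suffix eq ∘ ∈-++⁺ʳ ys ∘ there) (∉-suffix eq₁)

  Ascent⇒Point : ∀ {j m e} → Ascent j m e → Point j
  Ascent⇒Point (done outer)      = Outer⇒Point outer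
  Ascent⇒Point (climb inner _ _) = Inner⇒Point inner

  ascent-through : ∀ d {j m e} → 1 ≤ j → (∀ p → j ≤ p → p < j ℕ.+ d → Inner n w p) →
    Ascent (j ℕ.+ d) m e → Ascent j (d ℕ.+ m) e
  ascent-through zero {j} {m} {e} _ _ ascent = subst (λ t → Ascent t m e) (ℕP.+-identityʳ j) ascent
  ascent-through (suc d) {j} {m} {e} 1≤j inner ascent =
    climb (inner j ℕP.≤-refl (ℕP.m<m+n j (s≤s z≤n))) (⋖-suc 1≤j j<n)
      (ascent-through d (ℕP.≤-trans 1≤j (ℕP.n≤1+n j))
        (λ p j<p p<j+1+d → inner p (ℕP.<⇒≤ j<p) (subst (p <_) (sym (ℕP.+-suc j d)) p<j+1+d))
        (subst (λ t → Ascent t m e) (ℕP.+-suc j d) ascent))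
    where
    j<n : j < n
    j<n = ℕP.<-≤-trans (ℕP.m<m+n j (s≤s z≤n)) (proj₂ (Ascent⇒Point ascent))

  descent-through : ∀ d {j m e} → 1 ≤ j → (∀ p → j < p → p ≤ j ℕ.+ d → Outer n w p) →
    Descent j m e → Descent (j ℕ.+ d) (d ℕ.+ m) e
  descent-through zero {j} {m} {e} _ _ descent =
    subst (λ t → Descent t m e) (sym (ℕP.+-identityʳ j)) descent
  descent-through (suc d) {j} {m} {e} 1≤j outer descent =
    subst (λ t → Descent t (suc (d ℕ.+ m)) e) (sym (ℕP.+-suc j d))
      (descend (outer (suc (j ℕ.+ d)) (s≤s (ℕP.m≤m+n j d)) (ℕP.≤-reflexive (sym (ℕP.+-suc j d))))
        (subst (λ t → Descent t (d ℕ.+ m) e) (sym (prevIdx-suc (ℕP.≤-trans 1≤j (ℕP.m≤m+n j d))))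
          (descent-through d 1≤j
            (λ p j<p p≤j+d → outer p j<p (ℕP.≤-trans p≤j+d (ℕP.+-monoʳ-≤ j (ℕP.n≤1+n d))))
            descent)))

  outer-to-next : ∀ {r e x} → Outer n w r → x ≡ᵣ r → r < e → Outer n w e →
    (∀ p → r < p → p < e → Inner n w p) → product n w x ≡ x ℤ.- + r ℤ.+ + e
  outer-to-next {r} {e} {x} outer x≡r r<e outer-e inner = begin
    product n w x
      ≡⟨ outer-product outer x≡r (⋖-suc (proj₁ (Outer⇒Point outer)) r<n) ascent ⟩
    x ℤ.+ 1ℤ ℤ.+ + (d ℕ.+ 0)
      ≡⟨ solve 3 (λ x r d → x :+ con 1ℤ :+ (d :+ con 0ℤ) := x :- r :+ (con 1ℤ :+ r :+ d))
           refl x (+ r) (+ d) ⟩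
    x ℤ.- + r ℤ.+ + (suc r ℕ.+ d)
      ≡⟨ cong (λ t → x ℤ.- + r ℤ.+ + t) r+1+d≡e ⟩
    x ℤ.- + r ℤ.+ + e
      ∎
    where
    open ≡-Reasoning
    d : ℕ
    d = e ℕ.∸ suc r
    r+1+d≡e : suc r ℕ.+ d ≡ e
    r+1+d≡e = ℕP.m+[n∸m]≡n r<e
    r<n : r < n
    r<n = ℕP.<-≤-trans r<e (proj₂ (Outer⇒Point outer-e))
    ascent : Ascent (suc r) (d ℕ.+ 0) e
    ascent = ascent-through d (s≤s z≤n)
      (λ p r<p p<r+1+d → inner p r<p (subst (p <_) r+1+d≡e p<r+1+d))
      (subst (λ t → Ascent t 0 e) (sym r+1+d≡e) (done outer-e))

  outer-wrap : ∀ {r a x} → Outer n w r → x ≡ᵣ r → Outer n w a →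
    (∀ p → r < p → p ≤ n → Inner n w p) → (∀ p → 1 ≤ p → p < a → Inner n w p) →
    product n w x ≡ x ℤ.- + r ℤ.+ + a ℤ.+ 1ℤ ℤ.* + n
  outer-wrap {r} {a} {x} outer x≡r outer-a inner-above inner-below =
    [ from-below , from-top ]′ (ℕP.m≤n⇒m<n∨m≡n (proj₂ (Outer⇒Point outer)))
    where
    open ≡-Reasoning
    m : ℕ
    m = a ℕ.∸ 1
    1+m≡a : suc m ≡ a
    1+m≡a = ℕP.m+[n∸m]≡n (proj₁ (Outer⇒Point outer-a))
    ascent₁ : Ascent 1 (m ℕ.+ 0) a
    ascent₁ = ascent-through m ℕP.≤-refl
      (λ p 1≤p p<1+m → inner-below p 1≤p (subst (p <_) 1+m≡a p<1+m))
      (subst (λ t → Ascent t 0 a) (sym 1+m≡a) (done outer-a))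

    from-top : r ≡ n → product n w x ≡ x ℤ.- + r ℤ.+ + a ℤ.+ 1ℤ ℤ.* + n
    from-top r≡n = begin
      product n w x
        ≡⟨ outer-product outer x≡r (subst (_⋖ 1) (sym r≡n) wrap) ascent₁ ⟩
      x ℤ.+ 1ℤ ℤ.+ + (m ℕ.+ 0)
        ≡⟨ solve 3 (λ x m r → x :+ con 1ℤ :+ (m :+ con 0ℤ) := x :- r :+ (con 1ℤ :+ m) :+ con 1ℤ :* r)
             refl x (+ m) (+ r) ⟩
      x ℤ.- + r ℤ.+ + suc m ℤ.+ 1ℤ ℤ.* + r
        ≡⟨ cong₂ (λ s t → x ℤ.- + r ℤ.+ + s ℤ.+ 1ℤ ℤ.* + t) 1+m≡a r≡n ⟩
      x ℤ.- + r ℤ.+ + a ℤ.+ 1ℤ ℤ.* + n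
        ∎

    from-below : r < n → product n w x ≡ x ℤ.- + r ℤ.+ + a ℤ.+ 1ℤ ℤ.* + n
    from-below r<n = begin
      product n w x
        ≡⟨ outer-product outer x≡r (⋖-suc (proj₁ (Outer⇒Point outer)) r<n) ascent ⟩
      x ℤ.+ 1ℤ ℤ.+ + (d ℕ.+ suc (m ℕ.+ 0))
        ≡⟨ solve 4 (λ x r d m → x :+ con 1ℤ :+ (d :+ (con 1ℤ :+ (m :+ con 0ℤ)))
                                  := x :- r :+ (con 1ℤ :+ m) :+ con 1ℤ :* (con 1ℤ :+ r :+ d))
             refl x (+ r) (+ d) (+ m) ⟩
      x ℤ.- + r ℤ.+ + suc m ℤ.+ 1ℤ ℤ.* + (suc r ℕ.+ d)
        ≡⟨ cong₂ (λ s t → x ℤ.- + r ℤ.+ + s ℤ.+ 1ℤ ℤ.* + t) 1+m≡a r+1+d≡n ⟩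
      x ℤ.- + r ℤ.+ + a ℤ.+ 1ℤ ℤ.* + n
        ∎
      where
      d : ℕ
      d = n ℕ.∸ suc r
      r+1+d≡n : suc r ℕ.+ d ≡ n
      r+1+d≡n = ℕP.m+[n∸m]≡n r<n
      ascent : Ascent (suc r) (d ℕ.+ suc (m ℕ.+ 0)) a
      ascent = ascent-through d (s≤s z≤n)
        (λ p r<p p<r+1+d → inner-above p r<p (ℕP.<⇒≤ (subst (p <_) r+1+d≡n p<r+1+d)))
        (subst (λ t → Ascent t _ a) (sym r+1+d≡n) (climb (inner-above n r<n ℕP.≤-refl) wrap ascent₁))

  inner-to-next : ∀ {r e x} → Inner n w r → x ≡ᵣ r → e < r → Inner n w e →
    (∀ p → e < p → p < r → Outer n w p) → product n w x ≡ x ℤ.- + r ℤ.+ + e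
  inner-to-next {r} {e} {x} inner x≡r e<r inner-e outer = begin
    product n w x
      ≡⟨ inner-product inner x≡r (subst (λ t → Descent t (d ℕ.+ 0) e) (sym prev-r≡e+d) descent) ⟩
    x ℤ.- 1ℤ ℤ.- + (d ℕ.+ 0)
      ≡⟨ solve 3 (λ x e d → x :- con 1ℤ :- (d :+ con 0ℤ) := x :- (con 1ℤ :+ (e :+ d)) :+ e)
           refl x (+ e) (+ d) ⟩
    x ℤ.- + suc (e ℕ.+ d) ℤ.+ + e
      ≡⟨ cong (λ t → x ℤ.- + t ℤ.+ + e) e+1+d≡r ⟩
    x ℤ.- + r ℤ.+ + e
      ∎
    where
    open ≡-Reasoning
    1≤e : 1 ≤ e
    1≤e = proj₁ (Inner⇒Point inner-e)
    d : ℕ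
    d = r ℕ.∸ suc e
    e+1+d≡r : suc e ℕ.+ d ≡ r
    e+1+d≡r = ℕP.m+[n∸m]≡n e<r
    prev-r≡e+d : prevIdx n r ≡ e ℕ.+ d
    prev-r≡e+d = trans (cong (prevIdx n) (sym e+1+d≡r)) (prevIdx-suc (ℕP.≤-trans 1≤e (ℕP.m≤m+n e d)))
    descent : Descent (e ℕ.+ d) (d ℕ.+ 0) e
    descent = descent-through d 1≤e
      (λ p e<p p≤e+d → outer p e<p (subst (p <_) e+1+d≡r (s≤s p≤e+d)))
      (done inner-e)

  inner-wrap : ∀ {r b x} → Inner n w r → x ≡ᵣ r → Inner n w b →
    (∀ p → 1 ≤ p → p < r → Outer n w p) → (∀ p → b < p → p ≤ n → Outer n w p) →
    product n w x ≡ x ℤ.- + r ℤ.+ + b ℤ.+ -1ℤ ℤ.* + n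
  inner-wrap {r} {b} {x} inner x≡r inner-b outer-below outer-above =
    [ from-above , from-bottom ]′ (ℕP.m≤n⇒m<n∨m≡n (proj₁ (Inner⇒Point inner)))
    where
    open ≡-Reasoning
    d : ℕ
    d = n ℕ.∸ b
    b+d≡n : b ℕ.+ d ≡ n
    b+d≡n = ℕP.m+[n∸m]≡n (proj₂ (Inner⇒Point inner-b))
    descentₙ : Descent n (d ℕ.+ 0) b
    descentₙ = subst (λ t → Descent t (d ℕ.+ 0) b) b+d≡n
      (descent-through d (proj₁ (Inner⇒Point inner-b))
        (λ p b<p p≤b+d → outer-above p b<p (subst (p ≤_) b+d≡n p≤b+d))
        (done inner-b))

    from-bottom : 1 ≡ r → product n w x ≡ x ℤ.- + r ℤ.+ + b ℤ.+ -1ℤ ℤ.* + n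
    from-bottom 1≡r = begin
      product n w x
        ≡⟨ inner-product inner x≡r (subst (λ t → Descent (prevIdx n t) (d ℕ.+ 0) b) 1≡r descentₙ) ⟩
      x ℤ.- 1ℤ ℤ.- + (d ℕ.+ 0)
        ≡⟨ solve 3 (λ x b d → x :- con 1ℤ :- (d :+ con 0ℤ) := x :- con 1ℤ :+ b :+ con -1ℤ :* (b :+ d))
             refl x (+ b) (+ d) ⟩
      x ℤ.- + 1 ℤ.+ + b ℤ.+ -1ℤ ℤ.* + (b ℕ.+ d)
        ≡⟨ cong₂ (λ s t → x ℤ.- + s ℤ.+ + b ℤ.+ -1ℤ ℤ.* + t) 1≡r b+d≡n ⟩
      x ℤ.- + r ℤ.+ + b ℤ.+ -1ℤ ℤ.* + n
        ∎

    from-above : 1 < r → product n w x ≡ x ℤ.- + r ℤ.+ + b ℤ.+ -1ℤ ℤ.* + n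
    from-above 1<r = begin
      product n w x
        ≡⟨ inner-product inner x≡r descent′ ⟩
      x ℤ.- 1ℤ ℤ.- + (k ℕ.+ suc (d ℕ.+ 0))
        ≡⟨ solve 4 (λ x k b d → x :- con 1ℤ :- (k :+ (con 1ℤ :+ (d :+ con 0ℤ)))
                                  := x :- (con 1ℤ :+ (con 1ℤ :+ k)) :+ b :+ con -1ℤ :* (b :+ d))
             refl x (+ k) (+ b) (+ d) ⟩
      x ℤ.- + suc (suc k) ℤ.+ + b ℤ.+ -1ℤ ℤ.* + (b ℕ.+ d)
        ≡⟨ cong₂ (λ s t → x ℤ.- + s ℤ.+ + b ℤ.+ -1ℤ ℤ.* + t) 2+k≡r b+d≡n ⟩
      x ℤ.- + r ℤ.+ + b ℤ.+ -1ℤ ℤ.* + n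
        ∎
      where
      k : ℕ
      k = r ℕ.∸ 2
      2+k≡r : suc (suc k) ≡ r
      2+k≡r = ℕP.m+[n∸m]≡n 1<r
      prev-r≡1+k : prevIdx n r ≡ suc k
      prev-r≡1+k = cong (prevIdx n) (sym 2+k≡r)
      descent′ : Descent (prevIdx n r) (k ℕ.+ suc (d ℕ.+ 0)) b
      descent′ = subst (λ t → Descent t (k ℕ.+ suc (d ℕ.+ 0)) b) (sym prev-r≡1+k)
        (descent-through k ℕP.≤-refl
          (λ p 1<p p≤1+k → outer-below p (ℕP.<⇒≤ 1<p) (subst (p <_) 2+k≡r (s≤s p≤1+k)))
          (descend (outer-below 1 ℕP.≤-refl 1<r) descentₙ))

  private
    module Up   = InfiniteCycle n n≥2 1ℤ refl
    module Down = InfiniteCycle n n≥2 -1ℤ refl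
    module <-Sorted = Sorted {_≺_ = _<_} (λ {a b} → ℕP.<-asym {a} {b})
    module >-Sorted = Sorted {_≺_ = _>_} (λ {a b} → ℕP.<-asym {b} {a})
  open Equivalence

  not-enumerated-outer⇒Inner : ∀ {L p} → Enumerates (Outer n w) L → Point p → p ∉ L → Inner n w p
  not-enumerated-outer⇒Inner enum p-pt p∉L = ¬Outer⇒Inner p-pt (p∉L ∘ from (enum _) ∘ (p-pt ,_))

  not-enumerated-inner⇒Outer : ∀ {L p} → Enumerates (Inner n w) L → Point p → p ∉ L → Outer n w p
  not-enumerated-inner⇒Outer enum p-pt p∉L = ¬Inner⇒Outer p-pt (p∉L ∘ from (enum _) ∘ (p-pt ,_))

  outer-orbit : ∀ {as} → AllPairs _<_ as → Enumerates (Outer n w) as →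
    ∀ {x r} → Outer n w r → x ≡ᵣ r → product n w x ≡ infCycle n 1ℤ (map +_ as) x
  outer-orbit {[]} _ outers {r = r} outer _ with from (outers r) (Outer⇒Point outer , outer)
  ... | ()
  outer-orbit {a₁ ∷ L} sorted outers {x} {r} outer x≡r
    with Up.infCycle-image a₁ L (Enumerates⇒Points outers) (Outer⇒Point outer) x≡r
           (from (outers r) (Outer⇒Point outer , outer))
  ... | inj₁ (e , (pre , post , eq) , image≡) =
    trans (outer-to-next outer x≡r r<e outer-e inner-between) (sym image≡)
    where
    outer-e : Outer n w e
    outer-e = proj₂ (to (outers e) (subst (e ∈_) (sym eq) (∈-++⁺ʳ pre (there (here refl)))))
    r<e : r < e
    r<e = <-Sorted.consecutive-≺ pre post sorted eq
    inner-between : ∀ p → r < p → p < e → Inner n w p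
    inner-between p r<p p<e = not-enumerated-outer⇒Inner outers
      (ℕP.≤-trans (s≤s z≤n) r<p , ℕP.<⇒≤ (ℕP.<-≤-trans p<e (proj₂ (Outer⇒Point outer-e))))
      (<-Sorted.consecutive-gap pre post sorted eq r<p p<e)
  ... | inj₂ ((pre , eq) , image≡) =
    trans (outer-wrap outer x≡r outer-a₁ inner-above inner-below) (sym image≡)
    where
    outer-a₁ : Outer n w a₁
    outer-a₁ = proj₂ (to (outers a₁) (here refl))
    inner-above : ∀ p → r < p → p ≤ n → Inner n w p
    inner-above p r<p p≤n = not-enumerated-outer⇒Inner outers
      (ℕP.≤-trans (s≤s z≤n) r<p , p≤n) (<-Sorted.last-gap pre sorted eq r<p)
    inner-below : ∀ p → 1 ≤ p → p < a₁ → Inner n w p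
    inner-below p 1≤p p<a₁ = not-enumerated-outer⇒Inner outers
      (1≤p , ℕP.<⇒≤ (ℕP.<-≤-trans p<a₁ (proj₂ (Outer⇒Point outer-a₁)))) (<-Sorted.head-gap sorted p<a₁)

  inner-orbit : ∀ {bs} → AllPairs _>_ bs → Enumerates (Inner n w) bs →
    ∀ {x r} → Inner n w r → x ≡ᵣ r → product n w x ≡ infCycle n -1ℤ (map +_ bs) x
  inner-orbit {[]} _ inners {r = r} inner _ with from (inners r) (Inner⇒Point inner , inner)
  ... | ()
  inner-orbit {b₁ ∷ L} sorted inners {x} {r} inner x≡r
    with Down.infCycle-image b₁ L (Enumerates⇒Points inners) (Inner⇒Point inner) x≡r
           (from (inners r) (Inner⇒Point inner , inner))
  ... | inj₁ (e , (pre , post , eq) , image≡) =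
    trans (inner-to-next inner x≡r e<r inner-e outer-between) (sym image≡)
    where
    inner-e : Inner n w e
    inner-e = proj₂ (to (inners e) (subst (e ∈_) (sym eq) (∈-++⁺ʳ pre (there (here refl)))))
    e<r : e < r
    e<r = >-Sorted.consecutive-≺ pre post sorted eq
    outer-between : ∀ p → e < p → p < r → Outer n w p
    outer-between p e<p p<r = not-enumerated-inner⇒Outer inners
      (ℕP.≤-trans (s≤s z≤n) e<p , ℕP.<⇒≤ (ℕP.<-≤-trans p<r (proj₂ (Inner⇒Point inner))))
      (>-Sorted.consecutive-gap pre post sorted eq p<r e<p)
  ... | inj₂ ((pre , eq) , image≡) =
    trans (inner-wrap inner x≡r inner-b₁ outer-below outer-above) (sym image≡)
    where
    inner-b₁ : Inner n w b₁
    inner-b₁ = proj₂ (to (inners b₁) (here refl))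
    outer-below : ∀ p → 1 ≤ p → p < r → Outer n w p
    outer-below p 1≤p p<r = not-enumerated-inner⇒Outer inners
      (1≤p , ℕP.<⇒≤ (ℕP.<-≤-trans p<r (proj₂ (Inner⇒Point inner)))) (>-Sorted.last-gap pre sorted eq p<r)
    outer-above : ∀ p → b₁ < p → p ≤ n → Outer n w p
    outer-above p b₁<p p≤n = not-enumerated-inner⇒Outer inners
      (ℕP.≤-trans (s≤s z≤n) b₁<p , p≤n) (>-Sorted.head-gap sorted b₁<p)

  product≡infCycles : ∀ {as bs} → AllPairs _<_ as → Enumerates (Outer n w) as →
    AllPairs _>_ bs → Enumerates (Inner n w) bs →
    ∀ x → product n w x ≡ infCycle n 1ℤ (map +_ as) (infCycle n -1ℤ (map +_ bs) x)
  product≡infCycles {as} {bs} as-sorted outers bs-sorted inners x with residue-exists x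
  ... | r , r-pt , x≡r with Outer-or-Inner r-pt
  ...   | inj₁ outer = begin
    product n w x
      ≡⟨ outer-orbit as-sorted outers outer x≡r ⟩
    infCycle n 1ℤ (map +_ as) x
      ≡⟨ cong (infCycle n 1ℤ (map +_ as)) (sym bs-fix-x) ⟩
    infCycle n 1ℤ (map +_ as) (infCycle n -1ℤ (map +_ bs) x)
      ∎
    where
    open ≡-Reasoning
    bs-fix-x : infCycle n -1ℤ (map +_ bs) x ≡ x
    bs-fix-x = Down.infCycle-fix-outside bs (Enumerates⇒Points inners) r-pt x≡r
      (Precedes-asym outer ∘ proj₂ ∘ to (inners r))
  ...   | inj₂ inner
    with Down.infCycle-≡ᵣ bs (Enumerates⇒Points inners) r-pt x≡r (from (inners r) (r-pt , inner))
  ...     | e , e∈bs , y≡e = begin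
    product n w x
      ≡⟨ inner-orbit bs-sorted inners inner x≡r ⟩
    infCycle n -1ℤ (map +_ bs) x
      ≡⟨ sym as-fix-y ⟩
    infCycle n 1ℤ (map +_ as) (infCycle n -1ℤ (map +_ bs) x)
      ∎
    where
    open ≡-Reasoning
    e-inner : Point e × Inner n w e
    e-inner = to (inners e) e∈bs
    as-fix-y : infCycle n 1ℤ (map +_ as) (infCycle n -1ℤ (map +_ bs) x) ≡ infCycle n -1ℤ (map +_ bs) x
    as-fix-y = Up.infCycle-fix-outside as (Enumerates⇒Points outers) (proj₁ e-inner) y≡e
      (flip Precedes-asym (proj₂ e-inner) ∘ proj₂ ∘ to (outers e))

lemma3p6 : (n : ℕ) → 2 ≤ n → (w : List ℕ) → w ↭ indices n →
    (as bs : List ℕ) →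
    AllPairs _<_ as → (∀ p → (p ∈ as) ⇔ ((1 ≤ p × p ≤ n) × Outer n w p)) →
    AllPairs _>_ bs → (∀ p → (p ∈ bs) ⇔ ((1 ≤ p × p ≤ n) × Inner n w p)) →
    ∀ (x : ℤ) → product n w x ≡ infCycle n 1ℤ (map +_ as) (infCycle n -1ℤ (map +_ bs) x)
lemma3p6 n n≥2 w w↭ as bs = CoxeterWord.product≡infCycles n n≥2 w w↭
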